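{- Let $a,b,c$ be positive integers with $2\le a<b<c$ and $\gcd(a,b)=1$. Then $c$ can be written as $c=ab-ax-by$ for some integers $x,y>0$ if and only if $g(a,b,c)<g(a,b)$.
   Context: For relatively prime positive integers $a_1,\dots,a_n$ (each at least 2), the Frobenius number $g(a_1,\dots,a_n)$ is the largest integer that is not representable as $\sum_i c_ia_i$ with all $c_i$ nonnegative integers. -}

module Defs where

open import Data.Nat using (ℕ; zero; suc; _+_; _*_; _<_)
open import Data.Vec using (Vec; []; _∷_)
open import Data.Product using (∃; _×_)
open import Relation.Binary.PropositionalEquality using (_≡_)
open import Relation.Nullary using (¬_)

lincomb : ∀ {k} → Vec ℕ k → Vec ℕ k → ℕ
lincomb []       []       = 0
lincomb (c ∷ cs) (a ∷ as) = c * a + lincomb cs as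

Representable : ∀ {k} → Vec ℕ k → ℕ → Set
Representable {k} gens n = ∃ λ (cs : Vec ℕ k) → lincomb cs gens ≡ n

IsFrobenius : ∀ {k} → Vec ℕ k → ℕ → Set
IsFrobenius gens g = ¬ Representable gens g × (∀ m → g < m → Representable gens m)

{-# OPTIONS --safe #-}
module Submission where

-- For coprime a, b, Sylvester's description of the gaps: n is not a combination of a and b
-- exactly when n = ab − ax − by with x, y ≥ 1.  (Choose y ∈ [1, a] with n + by = ta; n is a
-- combination iff t ≥ b, and otherwise x = b − t.)  In particular g(a, b) = ab − a − b.
-- Every combination of a, b is one of a, b, c, so g(a, b, c) ≤ g(a, b), strictly iff g(a, b)
-- is a combination of a, b, c.  If c = ab − ax − by, then g(a, b) = c + a(x − 1) + b(y − 1).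
-- Conversely, if g(a, b) is a combination of a, b, c but not of a, b, then c is not a
-- combination of a and b, so c has Sylvester's form.

open import Defs
open import Data.Nat using (ℕ; zero; suc; _+_; _*_; _≤_; _<_; _≤?_; z≤n; s≤s; NonZero; >-nonZero; >-nonZero⁻¹)
open import Data.Nat.Properties
open import Data.Nat.GCD using (gcd; module Bézout)
open import Data.Nat.Coprimality using (Coprime; gcd≡1⇒coprime; coprime-Bézout; coprime-divisor)
open import Data.Nat.Divisibility using (_∣_; divides; ∣m+n∣m⇒∣n; m∣m*n; n∣m*n; ∣n⇒∣m*n; ∣⇒≤)
open import Data.Nat.DivMod using (_%_; _/_; m≡m%n+[m/n]*n; m%n<n)
open import Data.Nat.Tactic.RingSolver using (solve-∀)
open import Data.Vec using (Vec; []; _∷_; _∷ʳ_; zipWith; map; initLast)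
open import Data.Product using (∃; ∃₂; _×_; _,_)
open import Data.Sum using (_⊎_; inj₁; inj₂; fromInj₂)
open import Data.Empty using (⊥-elim)
open import Function using (_∘_)
open import Relation.Nullary using (¬_; yes; no)
open import Relation.Binary.PropositionalEquality
open import Function.Bundles using (_⇔_; mk⇔)
open import Function.Construct.Composition using (_⇔-∘_)
open import Function.Construct.Symmetry using (⇔-sym)

lincomb-∷ʳ : ∀ {k} (cs gens : Vec ℕ k) c g → lincomb (cs ∷ʳ c) (gens ∷ʳ g) ≡ lincomb cs gens + c * g
lincomb-∷ʳ []       []         c g = +-identityʳ (c * g)
lincomb-∷ʳ (d ∷ cs) (h ∷ gens) c g = begin
  d * h + lincomb (cs ∷ʳ c) (gens ∷ʳ g) ≡⟨ cong (d * h +_) (lincomb-∷ʳ cs gens c g) ⟩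
  d * h + (lincomb cs gens + c * g)     ≡⟨ +-assoc (d * h) _ _ ⟨
  d * h + lincomb cs gens + c * g       ∎
  where open ≡-Reasoning

lincomb-zipWith-+ : ∀ {k} (cs ds gens : Vec ℕ k) →
  lincomb (zipWith _+_ cs ds) gens ≡ lincomb cs gens + lincomb ds gens
lincomb-zipWith-+ []       []       []         = refl
lincomb-zipWith-+ (c ∷ cs) (d ∷ ds) (g ∷ gens) = begin
  (c + d) * g + lincomb (zipWith _+_ cs ds) gens    ≡⟨ cong ((c + d) * g +_) (lincomb-zipWith-+ cs ds gens) ⟩
  (c + d) * g + (lincomb cs gens + lincomb ds gens) ≡⟨ distrib c d g _ _ ⟩
  c * g + lincomb cs gens + (d * g + lincomb ds gens) ∎
  where
  distrib : ∀ c d g l m → (c + d) * g + (l + m) ≡ c * g + l + (d * g + m)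
  distrib = solve-∀
  open ≡-Reasoning

lincomb-map-* : ∀ {k} m (cs gens : Vec ℕ k) → lincomb (map (m *_) cs) gens ≡ m * lincomb cs gens
lincomb-map-* m []       []         = sym (*-zeroʳ m)
lincomb-map-* m (c ∷ cs) (g ∷ gens) = begin
  m * c * g + lincomb (map (m *_) cs) gens ≡⟨ cong₂ _+_ (*-assoc m c g) (lincomb-map-* m cs gens) ⟩
  m * (c * g) + m * lincomb cs gens        ≡⟨ *-distribˡ-+ m (c * g) _ ⟨
  m * (c * g + lincomb cs gens)            ∎
  where open ≡-Reasoning

module _ {k} {gens : Vec ℕ k} where

  Representable-+ : ∀ {m n} → Representable gens m → Representable gens n → Representable gens (m + n)
  Representable-+ (cs , refl) (ds , refl) = zipWith _+_ cs ds , lincomb-zipWith-+ cs ds gens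

  Representable-* : ∀ m {n} → Representable gens n → Representable gens (m * n)
  Representable-* m (cs , refl) = map (m *_) cs , lincomb-map-* m cs gens

  Representable-∷ʳ⁺ : ∀ g {n} → Representable gens n → Representable (gens ∷ʳ g) n
  Representable-∷ʳ⁺ g (cs , refl) = cs ∷ʳ 0 , trans (lincomb-∷ʳ cs gens 0 g) (+-identityʳ _)

  Representable-∷ʳ⁻ : ∀ {g n} → Representable gens g → Representable (gens ∷ʳ g) n → Representable gens n
  Representable-∷ʳ⁻ {g} g-rep (cs′ , refl) with initLast cs′
  ... | cs , c , refl = subst (Representable gens) (sym (lincomb-∷ʳ cs gens c g))
                          (Representable-+ (cs , refl) (Representable-* c g-rep))

frobenius-<⇔representable : ∀ {k l} {gens : Vec ℕ k} {gens′ : Vec ℕ l} {g g′} →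
  (∀ {n} → Representable gens n → Representable gens′ n) →
  IsFrobenius gens g → IsFrobenius gens′ g′ → (g′ < g ⇔ Representable gens′ g)
frobenius-<⇔representable gens⊆gens′ (_ , rep>) (¬rep′ , rep>′) = mk⇔ (rep>′ _) λ rep →
  ≤∧≢⇒< (≮⇒≥ (λ g<g′ → ¬rep′ (gens⊆gens′ (rep> _ g<g′)))) (λ { refl → ¬rep′ rep })

SylvesterGap : ℕ → ℕ → ℕ → Set
SylvesterGap a b n = ∃₂ λ (x y : ℕ) → 1 ≤ x × 1 ≤ y × n + a * x + b * y ≡ a * b

-- Bézout gives b·y ≡ ∓1 (mod a); in the case +1, multiply by a − 1.
coprime⇒∃[y]a∣n+b*y : ∀ {a b} .{{_ : NonZero a}} → Coprime a b → ∀ n → ∃ λ y → a ∣ n + b * y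
coprime⇒∃[y]a∣n+b*y {suc a′} {b} cop n with coprime-Bézout cop
... | Bézout.+- x y 1+yb≡xa = n * y , divides (n * x) (begin
  n + b * (n * y) ≡⟨ factor n y b ⟩
  n * (1 + y * b) ≡⟨ cong (n *_) 1+yb≡xa ⟩
  n * (x * suc a′) ≡⟨ *-assoc n x _ ⟨
  n * x * suc a′  ∎)
  where
  factor : ∀ n y b → n + b * (n * y) ≡ n * (1 + y * b)
  factor = solve-∀
  open ≡-Reasoning
... | Bézout.-+ x y 1+xa≡yb = n * a′ * y , divides (n + n * a′ * x) (begin
  n + b * (n * a′ * y)          ≡⟨ factor n a′ y b ⟩
  n + n * a′ * (y * b)          ≡⟨ cong (λ m → n + n * a′ * m) 1+xa≡yb ⟨
  n + n * a′ * (1 + x * suc a′) ≡⟨ expand n a′ x ⟩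
  (n + n * a′ * x) * suc a′     ∎)
  where
  factor : ∀ n a′ y b → n + b * (n * a′ * y) ≡ n + n * a′ * (y * b)
  factor = solve-∀
  expand : ∀ n a′ x → n + n * a′ * (1 + x * suc a′) ≡ (n + n * a′ * x) * suc a′
  expand = solve-∀
  open ≡-Reasoning

a∣n+b*y⇒a∣n+b*[y%a] : ∀ {a} .{{_ : NonZero a}} n b y → a ∣ n + b * y → a ∣ n + b * (y % a)
a∣n+b*y⇒a∣n+b*[y%a] {a} n b y a∣n+b*y =
  ∣m+n∣m⇒∣n (subst (a ∣_) split a∣n+b*y) (∣n⇒∣m*n b (n∣m*n (y / a)))
  where
  rearrange : ∀ n b r q a → n + b * (r + q * a) ≡ b * (q * a) + (n + b * r)
  rearrange = solve-∀
  split : n + b * y ≡ b * (y / a * a) + (n + b * (y % a))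
  split = trans (cong (λ m → n + b * m) (m≡m%n+[m/n]*n y a)) (rearrange n b (y % a) (y / a) a)

-- Shifting n by b moves the residue y from [0, a) to [1, a].
coprime⇒∃[1≤y≤a]n+b*y≡t*a : ∀ {a b} .{{_ : NonZero a}} → Coprime a b → ∀ n →
  ∃₂ λ y t → 1 ≤ y × y ≤ a × n + b * y ≡ t * a
coprime⇒∃[1≤y≤a]n+b*y≡t*a {a} {b} cop n with coprime⇒∃[y]a∣n+b*y cop (n + b)
... | y , a∣n+b+b*y with a∣n+b*y⇒a∣n+b*[y%a] (n + b) b y a∣n+b+b*y
... | divides t e = suc (y % a) , t , s≤s z≤n , m%n<n y a , (begin
  n + b * suc (y % a)   ≡⟨ cong (n +_) (*-suc b (y % a)) ⟩
  n + (b + b * (y % a)) ≡⟨ +-assoc n b _ ⟨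
  n + b + b * (y % a)   ≡⟨ e ⟩
  t * a                 ∎)
  where open ≡-Reasoning

residue⇒representable : ∀ {a b n} y t → y ≤ a → b ≤ t → n + b * y ≡ t * a →
  Representable (a ∷ b ∷ []) n
residue⇒representable {b = b} {n} y t y≤a b≤t e
  with m≤n⇒∃[o]m+o≡n y≤a | m≤n⇒∃[o]m+o≡n b≤t
... | z , refl | s , refl = (s ∷ z ∷ []) , +-cancelʳ-≡ (b * y) _ _ (begin
  s * (y + z) + (z * b + 0) + b * y ≡⟨ expand s y z b ⟩
  (b + s) * (y + z)                 ≡⟨ e ⟨
  n + b * y                         ∎)
  where
  expand : ∀ s y z b → s * (y + z) + (z * b + 0) + b * y ≡ (b + s) * (y + z)
  expand = solve-∀
  open ≡-Reasoning

residue⇒sylvesterGap : ∀ {a b n} y t → 1 ≤ y → t < b → n + b * y ≡ t * a → SylvesterGap a b n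
residue⇒sylvesterGap {a} {n = n} y t 1≤y t<b e with m≤n⇒∃[o]m+o≡n t<b
... | x′ , refl = suc x′ , y , s≤s z≤n , 1≤y , (begin
  n + a * suc x′ + b * y ≡⟨ swap n (a * suc x′) (b * y) ⟩
  n + b * y + a * suc x′ ≡⟨ cong (_+ a * suc x′) e ⟩
  t * a + a * suc x′     ≡⟨ collect t a x′ ⟩
  a * (suc t + x′)       ∎)
  where
  b = suc t + x′
  swap : ∀ n u v → n + u + v ≡ n + v + u
  swap = solve-∀
  collect : ∀ t a x′ → t * a + a * suc x′ ≡ a * (suc t + x′)
  collect = solve-∀
  open ≡-Reasoning

representable⊎sylvesterGap : ∀ {a b} .{{_ : NonZero a}} → Coprime a b → ∀ n →
  Representable (a ∷ b ∷ []) n ⊎ SylvesterGap a b n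
representable⊎sylvesterGap {b = b} cop n with coprime⇒∃[1≤y≤a]n+b*y≡t*a cop n
... | y , t , 1≤y , y≤a , e with b ≤? t
...   | yes b≤t = inj₁ (residue⇒representable y t y≤a b≤t e)
...   | no b≰t  = inj₂ (residue⇒sylvesterGap y t 1≤y (≰⇒> b≰t) e)

-- From n = ia + jb we get (i + x)a + b(j + y) = ab, and a ∣ j + y forces b(j + y) ≥ ab.
sylvesterGap⇒¬representable : ∀ {a b n} .{{_ : NonZero a}} → Coprime a b → SylvesterGap a b n →
  ¬ Representable (a ∷ b ∷ []) n
sylvesterGap⇒¬representable {a} {b} cop (x , y , 1≤x , 1≤y , e) ((i ∷ j ∷ []) , refl) =
  <-irrefl refl (begin-strict
    a * b                     ≡⟨ *-comm a b ⟩
    b * a                     ≤⟨ *-monoʳ-≤ b a≤j+y ⟩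
    b * (j + y)               <⟨ m<n+m _ (>-nonZero⁻¹ a) ⟩
    a + b * (j + y)           ≤⟨ +-monoˡ-≤ _ (m≤n*m a (i + x) {{>-nonZero i+x>0}}) ⟩
    (i + x) * a + b * (j + y) ≡⟨ sum≡ab ⟩
    a * b                     ∎)
  where
  open ≤-Reasoning
  regroup : ∀ i j a b x y → (i + x) * a + b * (j + y) ≡ i * a + (j * b + 0) + a * x + b * y
  regroup = solve-∀
  sum≡ab : (i + x) * a + b * (j + y) ≡ a * b
  sum≡ab = trans (regroup i j a b x y) e
  i+x>0 : 0 < i + x
  i+x>0 = ≤-trans 1≤x (m≤n+m x i)
  a∣j+y : a ∣ j + y
  a∣j+y = coprime-divisor cop (∣m+n∣m⇒∣n (subst (a ∣_) (sym sum≡ab) (m∣m*n b)) (n∣m*n (i + x)))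
  a≤j+y : a ≤ j + y
  a≤j+y = ∣⇒≤ {{>-nonZero (≤-trans 1≤y (m≤n+m y j))}} a∣j+y

sylvesterGap⇒+a+b≤ab : ∀ {a b n} → SylvesterGap a b n → n + a + b ≤ a * b
sylvesterGap⇒+a+b≤ab {a} {b} {n} (x , y , 1≤x , 1≤y , e) = begin
  n + a + b         ≡⟨ cong₂ (λ u v → n + u + v) (*-identityʳ a) (*-identityʳ b) ⟨
  n + a * 1 + b * 1 ≤⟨ +-mono-≤ (+-monoʳ-≤ n (*-monoʳ-≤ a 1≤x)) (*-monoʳ-≤ b 1≤y) ⟩
  n + a * x + b * y ≡⟨ e ⟩
  a * b             ∎
  where open ≤-Reasoning

+a+b≡ab⇒sylvesterGap : ∀ {a b n} → n + a + b ≡ a * b → SylvesterGap a b n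
+a+b≡ab⇒sylvesterGap {a} {b} {n} e =
  1 , 1 , ≤-refl , ≤-refl , trans (cong₂ (λ u v → n + u + v) (*-identityʳ a) (*-identityʳ b)) e

frobenius[a,b]+a+b≡ab : ∀ {a b g} .{{_ : NonZero a}} → Coprime a b → IsFrobenius (a ∷ b ∷ []) g →
  g + a + b ≡ a * b
frobenius[a,b]+a+b≡ab {a} {b} {g} cop (¬rep , rep>) =
  ≤-antisym (sylvesterGap⇒+a+b≤ab {a} {b} gap) (≮⇒≥ no-larger-gap)
  where
  gap : SylvesterGap a b g
  gap = fromInj₂ (⊥-elim ∘ ¬rep) (representable⊎sylvesterGap cop g)
  shift : ∀ g k a b → suc g + k + a + b ≡ suc (g + a + b) + k
  shift = solve-∀
  no-larger-gap : ¬ (g + a + b < a * b)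
  no-larger-gap g+a+b<ab with m≤n⇒∃[o]m+o≡n g+a+b<ab
  ... | k , e = sylvesterGap⇒¬representable cop (+a+b≡ab⇒sylvesterGap {a} {b} (trans (shift g k a b) e))
                  (rep> (suc g + k) (s≤s (m≤m+n g k)))

sylvesterGap⇔frobenius-representable : ∀ {a b c g} .{{_ : NonZero a}} → Coprime a b →
  IsFrobenius (a ∷ b ∷ []) g → SylvesterGap a b c ⇔ Representable (a ∷ b ∷ c ∷ []) g
sylvesterGap⇔frobenius-representable {a} {b} {c} {g} cop frob@(¬rep , _) = mk⇔ to from
  where
  open ≡-Reasoning
  regroup : ∀ a b c x′ y′ → x′ * a + (y′ * b + (1 * c + 0)) + (a + b) ≡ c + a * suc x′ + b * suc y′
  regroup = solve-∀
  to : SylvesterGap a b c → Representable (a ∷ b ∷ c ∷ []) g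
  to (zero   , _      , () , _  , _)
  to (_      , zero   , _  , () , _)
  to (suc x′ , suc y′ , _  , _  , e) = (x′ ∷ y′ ∷ 1 ∷ []) , +-cancelʳ-≡ (a + b) _ _ (begin
    x′ * a + (y′ * b + (1 * c + 0)) + (a + b) ≡⟨ regroup a b c x′ y′ ⟩
    c + a * suc x′ + b * suc y′               ≡⟨ e ⟩
    a * b                                     ≡⟨ frobenius[a,b]+a+b≡ab cop frob ⟨
    g + a + b                                 ≡⟨ +-assoc g a b ⟩
    g + (a + b)                               ∎)
  from : Representable (a ∷ b ∷ c ∷ []) g → SylvesterGap a b c
  from g-rep = fromInj₂ (λ c-rep → ⊥-elim (¬rep (Representable-∷ʳ⁻ c-rep g-rep)))
                        (representable⊎sylvesterGap cop c)

proposition3 : (a b c : ℕ) → 2 ≤ a → a < b → b < c → gcd a b ≡ 1 →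
    (gabc gab : ℕ) → IsFrobenius (a ∷ b ∷ c ∷ []) gabc → IsFrobenius (a ∷ b ∷ []) gab →
    ((∃₂ λ (x y : ℕ) → 1 ≤ x × 1 ≤ y × c + a * x + b * y ≡ a * b) ⇔ gabc < gab)
proposition3 a b c (s≤s _) _ _ gcd≡1 gabc gab frob₃ frob₂ =
  ⇔-sym (frobenius-<⇔representable (Representable-∷ʳ⁺ c) frob₂ frob₃)
    ⇔-∘ sylvesterGap⇔frobenius-representable (gcd≡1⇒coprime gcd≡1) frob₂
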